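{- Let $C\subseteq\{N,H,D,R,L,Fa,Fu\}$. Then for all sequents $\{\Gamma_i\Rightarrow\Delta_i\}_{i\in I}$ and $\Gamma\Rightarrow\Delta$: $\{\Gamma_i\Rightarrow\Delta_i\}_{i\in I}\vdash_{\mathbf{STL}(C)}\Gamma\Rightarrow\Delta$ iff $\{\Gamma_i\Rightarrow\Delta_i\}_{i\in I}\vDash_{\mathcal{V}(C)}\Gamma\Rightarrow\Delta$.
   Context: \textbf{Calculus.} Language $\mathcal{L}=\{\wedge,\vee,\to,\top,\bot,\nabla\}$. When $H\in C$ the language is $\mathcal{L}\cup\{\supset\}$. A sequent is $\Gamma\Rightarrow\Delta$ with $\Gamma,\Delta$ finite multisets, $|\Delta|\le1$; $\nabla\Gamma=\{\nabla\gamma\mid\gamma\in\Gamma\}$. $\mathbf{STL}$ rules (premises / conclusion): - Axioms: $A\Rightarrow A$; $\bot\Rightarrow$; $\Rightarrow\top$. - Weakening: $\Gamma\Rightarrow\Delta$ / $\Gamma,A\Rightarrow\Delta$; $\Gamma\Rightarrow$ / $\Gamma\Rightarrow A$. - Contraction: $\Gamma,A,A\Rightarrow\Delta$ / $\Gamma,A\Rightarrow\Delta$. - Cut: $\Gamma\Rightarrow A$, $\Pi,A\Rightarrow\Delta$ / $\Pi,\Gamma\Rightarrow\Delta$. - Conjunction: $\Gamma,A\Rightarrow\Delta$ / $\Gamma,A\wedge B\Rightarrow\Delta$; $\Gamma,B\Rightarrow\Delta$ / $\Gamma,A\wedge B\Rightarrow\Delta$; $\Gamma\Rightarrow A$, $\Gamma\Rightarrow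 B$ / $\Gamma\Rightarrow A\wedge B$. - Disjunction: $A\Rightarrow\Delta$, $B\Rightarrow\Delta$ / $A\vee B\Rightarrow\Delta$; $\Gamma\Rightarrow A$ / $\Gamma\Rightarrow A\vee B$; $\Gamma\Rightarrow B$ / $\Gamma\Rightarrow A\vee B$. - Modality: $A\Rightarrow B$ / $\nabla A\Rightarrow\nabla B$. - Left implication: $\Gamma\Rightarrow A$, $\Gamma,B\Rightarrow\Delta$ / $\Gamma,\nabla(A\to B)\Rightarrow\Delta$. - Right implication: $\nabla\Gamma,A\Rightarrow B$ / $\Gamma\Rightarrow A\to B$. Additional rules: - (R): $\Gamma\Rightarrow A$ / $\Gamma\Rightarrow\nabla A$. - (L): $\Gamma,A\Rightarrow\Delta$ / $\Gamma,\nabla A\Rightarrow\Delta$. - (D): $\Gamma,A\Rightarrow\Delta$, $\Gamma,B\Rightarrow\Delta$ / $\Gamma,A\vee B\Rightarrow\Delta$. - (N): $\Gamma\Rightarrow\Delta$ / $\nabla\Gamma\Rightarrow\nabla\Delta$. - (Fa): $\Gamma,A\Rightarrow B$ / $\Gamma\Rightarrow\nabla(A\to B)$. - (Fu): $\nabla\Gamma\Rightarrow A$, $\nabla\Gamma,B\Rightarrow\nabla\Delta$ / $\Gamma,A\to B\Rightarrow\Delta$. - (H): adds the intuitionistic implication rules $\Gamma\Rightarrow A$, $\Gamma,B\Rightarrow\Delta$ / $\Gamma,A\supset B\Rightarrow\Delta$ and $\Gamma,A\Rightarrow B$ / $\Gamma\Rightarrow A\supset B$. $\mathbf{STL}(C)$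 is $\mathbf{STL}$ plus the rules in $C$. $\mathcal{S}\vdash_G S$ means $S$ is derivable from premises $\mathcal{S}$ by finitely many rule applications of $G$. \textbf{Algebras.} A $\nabla$-algebra is $(\mathsf{A},\nabla,\to)$ with $\mathsf{A}$ a bounded lattice and $\nabla c\wedge a\le b$ iff $c\le a\to b$. Properties: - N: $\nabla1=1$, $\nabla(a\wedge b)=\nabla a\wedge\nabla b$. - H: $\mathsf{A}$ a Heyting algebra. - D: distributive. - R: $a\le\nabla a$. - L: $\nabla a\le a$. - Fa: $\nabla$ surjective. - Fu: $a\mapsto1\to a$ surjective. $\mathcal{V}(C)$ is the class of $\nabla$-algebras with the properties in $C$. \textbf{Semantics.} An algebraic model is a $\nabla$-algebra with a valuation $V$ from formulas to $A$ commuting with all connectives: $\top,\bot$ go to $1,0$; $\nabla$ goes to $\nabla$; $\wedge,\vee,\to$ go to the corresponding operations; $\supset$ goes to the Heyting implication when present. $(\mathcal{A},V)\vDash\Gamma\Rightarrow\Delta$ if $\bigwedge V[\Gamma]\le\bigvee V[\Delta]$. $\mathcal{S}\vDash_{\mathfrak{C}}S$ means every algebraic model over an algebra in $\mathfrak{C}$ validating all of $\mathcal{S}$ validates $S$. -}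

module Defs where

open import Level using (Level; _⊔_; Lift; lower) renaming (suc to lsuc)
open import Data.Bool using (Bool; true; false; T)
open import Data.Nat using (ℕ)
open import Data.List using (List; []; _∷_; _++_; map; foldr)
open import Data.Maybe using (Maybe; just; nothing; maybe)
open import Data.Product using (Σ; ∃; _×_)
open import Function.Bundles using (_⇔_)
open import Function.Base using (_$_)
open import Relation.Binary.Lattice.Bundles using (BoundedLattice)
open import Relation.Binary.Lattice.Definitions using (Exponential)
open import Data.List.Relation.Binary.Permutation.Propositional using (_↭_)

data Prop7 : Set where
  N H D R L Fa Fu : Prop7

Sub : Set
Sub = Prop7 → Bool

_∈C_ : Prop7 → Sub → Set
p ∈C C = T (C p)

-- Formulas.  The Bool index says whether the intuitionistic
-- implication ⊃ is part of the language (it is iff H ∈ C).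
-- Propositional atoms are indexed by ℕ.

infixr 7 _∧'_
infixr 6 _∨'_
infixr 5 _→'_

data Fm (b : Bool) : Set where
  var   : ℕ → Fm b
  ⊤' ⊥' : Fm b
  _∧'_ _∨'_ _→'_ : Fm b → Fm b → Fm b
  ∇'    : Fm b → Fm b
  sup   : T b → Fm b → Fm b → Fm b     -- A ⊃ B, only when b = true

Lang : Sub → Bool
Lang C = C H

Form : Sub → Set
Form C = Fm (Lang C)

-- Sequents Γ ⇒ Δ: Γ a finite multiset (list up to permutation, see the
-- exchange rule below), Δ with at most one element (Maybe).
record Sequent (C : Sub) : Set where
  constructor _⇒_
  field
    ante : List (Form C)
    succ : Maybe (Form C)

infix 3 _⇒_

∇L : ∀ {b} → List (Fm b) → List (Fm b)
∇L = map ∇'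

∇M : ∀ {b} → Maybe (Fm b) → Maybe (Fm b)
∇M nothing  = nothing
∇M (just A) = just (∇' A)

data Der (C : Sub) {I : Set} (P : I → Sequent C) : Sequent C → Set where
  prem  : (i : I) → Der C P (P i)
  exch  : ∀ {Γ Γ' Δ} → Γ ↭ Γ' → Der C P (Γ ⇒ Δ) → Der C P (Γ' ⇒ Δ)
  ax    : ∀ A → Der C P (A ∷ [] ⇒ just A)
  ax⊥   : Der C P (⊥' ∷ [] ⇒ nothing)
  ax⊤   : Der C P ([] ⇒ just ⊤')
  wkL   : ∀ {Γ Δ} A → Der C P (Γ ⇒ Δ) → Der C P (A ∷ Γ ⇒ Δ)
  wkR   : ∀ {Γ} A → Der C P (Γ ⇒ nothing) → Der C P (Γ ⇒ just A)
  ctr   : ∀ {Γ Δ A} → Der C P (A ∷ A ∷ Γ ⇒ Δ) → Der C P (A ∷ Γ ⇒ Δ)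
  cut   : ∀ {Γ Π Δ A} → Der C P (Γ ⇒ just A) → Der C P (A ∷ Π ⇒ Δ)
        → Der C P (Π ++ Γ ⇒ Δ)
  ∧L₁   : ∀ {Γ Δ A} B → Der C P (A ∷ Γ ⇒ Δ) → Der C P ((A ∧' B) ∷ Γ ⇒ Δ)
  ∧L₂   : ∀ {Γ Δ B} A → Der C P (B ∷ Γ ⇒ Δ) → Der C P ((A ∧' B) ∷ Γ ⇒ Δ)
  ∧R    : ∀ {Γ A B} → Der C P (Γ ⇒ just A) → Der C P (Γ ⇒ just B)
        → Der C P (Γ ⇒ just (A ∧' B))
  ∨L    : ∀ {Δ A B} → Der C P (A ∷ [] ⇒ Δ) → Der C P (B ∷ [] ⇒ Δ)
        → Der C P ((A ∨' B) ∷ [] ⇒ Δ)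
  ∨R₁   : ∀ {Γ A} B → Der C P (Γ ⇒ just A) → Der C P (Γ ⇒ just (A ∨' B))
  ∨R₂   : ∀ {Γ B} A → Der C P (Γ ⇒ just B) → Der C P (Γ ⇒ just (A ∨' B))
  ∇mon  : ∀ {A B} → Der C P (A ∷ [] ⇒ just B)
        → Der C P (∇' A ∷ [] ⇒ just (∇' B))
  →L    : ∀ {Γ Δ A B} → Der C P (Γ ⇒ just A) → Der C P (B ∷ Γ ⇒ Δ)
        → Der C P (∇' (A →' B) ∷ Γ ⇒ Δ)
  →R    : ∀ {Γ A B} → Der C P (A ∷ ∇L Γ ⇒ just B) → Der C P (Γ ⇒ just (A →' B))
  ruleR  : R ∈C C → ∀ {Γ A} → Der C P (Γ ⇒ just A) → Der C P (Γ ⇒ just (∇' A))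
  ruleL  : L ∈C C → ∀ {Γ Δ A} → Der C P (A ∷ Γ ⇒ Δ) → Der C P (∇' A ∷ Γ ⇒ Δ)
  ruleD  : D ∈C C → ∀ {Γ Δ A B} → Der C P (A ∷ Γ ⇒ Δ) → Der C P (B ∷ Γ ⇒ Δ)
         → Der C P ((A ∨' B) ∷ Γ ⇒ Δ)
  ruleN  : N ∈C C → ∀ {Γ Δ} → Der C P (Γ ⇒ Δ) → Der C P (∇L Γ ⇒ ∇M Δ)
  ruleFa : Fa ∈C C → ∀ {Γ A B} → Der C P (A ∷ Γ ⇒ just B)
         → Der C P (Γ ⇒ just (∇' (A →' B)))
  ruleFu : Fu ∈C C → ∀ {Γ Δ A B} → Der C P (∇L Γ ⇒ just A)
         → Der C P (B ∷ ∇L Γ ⇒ ∇M Δ) → Der C P ((A →' B) ∷ Γ ⇒ Δ)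
  ruleH⊃L : (h : H ∈C C) → ∀ {Γ Δ A B} → Der C P (Γ ⇒ just A)
          → Der C P (B ∷ Γ ⇒ Δ) → Der C P (sup h A B ∷ Γ ⇒ Δ)
  ruleH⊃R : (h : H ∈C C) → ∀ {Γ A B} → Der C P (A ∷ Γ ⇒ just B)
          → Der C P (Γ ⇒ just (sup h A B))

record NablaAlgebra (c ℓ₁ ℓ₂ : Level) : Set (lsuc (c ⊔ ℓ₁ ⊔ ℓ₂)) where
  field
    boundedLattice : BoundedLattice c ℓ₁ ℓ₂
  open BoundedLattice boundedLattice public
  field
    ∇   : Carrier → Carrier
    _⇾_ : Carrier → Carrier → Carrier
    adj : ∀ a b c → ((∇ c ∧ a) ≤ b) ⇔ (c ≤ (a ⇾ b))

Holds : ∀ {c ℓ₁ ℓ₂} → Prop7 → NablaAlgebra c ℓ₁ ℓ₂ → Set (c ⊔ ℓ₁ ⊔ ℓ₂)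
Holds {c} {ℓ₁} {ℓ₂} N 𝔸 = Lift (c ⊔ ℓ₁ ⊔ ℓ₂) $ (∇ ⊤ ≈ ⊤) × (∀ a b → ∇ (a ∧ b) ≈ (∇ a ∧ ∇ b))
  where open NablaAlgebra 𝔸
Holds {c} {ℓ₁} {ℓ₂} H 𝔸 = Lift (c ⊔ ℓ₁ ⊔ ℓ₂) $ Σ (Carrier → Carrier → Carrier) (Exponential _≤_ _∧_)
  where open NablaAlgebra 𝔸
Holds {c} {ℓ₁} {ℓ₂} D 𝔸 = Lift (c ⊔ ℓ₁ ⊔ ℓ₂) $ ∀ x y z → (x ∧ (y ∨ z)) ≈ ((x ∧ y) ∨ (x ∧ z))
  where open NablaAlgebra 𝔸
Holds {c} {ℓ₁} {ℓ₂} R 𝔸 = Lift (c ⊔ ℓ₁ ⊔ ℓ₂) $ ∀ a → a ≤ ∇ a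
  where open NablaAlgebra 𝔸
Holds {c} {ℓ₁} {ℓ₂} L 𝔸 = Lift (c ⊔ ℓ₁ ⊔ ℓ₂) $ ∀ a → ∇ a ≤ a
  where open NablaAlgebra 𝔸
Holds {c} {ℓ₁} {ℓ₂} Fa 𝔸 = Lift (c ⊔ ℓ₁ ⊔ ℓ₂) $ ∀ a → ∃ λ b → ∇ b ≈ a
  where open NablaAlgebra 𝔸
Holds {c} {ℓ₁} {ℓ₂} Fu 𝔸 = Lift (c ⊔ ℓ₁ ⊔ ℓ₂) $ ∀ a → ∃ λ b → (⊤ ⇾ b) ≈ a
  where open NablaAlgebra 𝔸

InV : ∀ {c ℓ₁ ℓ₂} → Sub → NablaAlgebra c ℓ₁ ℓ₂ → Set (c ⊔ ℓ₁ ⊔ ℓ₂)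
InV C 𝔸 = ∀ p → p ∈C C → Holds p 𝔸

module _ {c ℓ₁ ℓ₂} {C : Sub} (𝔸 : NablaAlgebra c ℓ₁ ℓ₂) (inV : InV C 𝔸)
         (V : ℕ → NablaAlgebra.Carrier 𝔸) where
  open NablaAlgebra 𝔸

  ⟦_⟧ : Form C → Carrier
  ⟦ var n ⟧     = V n
  ⟦ ⊤' ⟧        = ⊤
  ⟦ ⊥' ⟧        = ⊥
  ⟦ A ∧' B ⟧    = ⟦ A ⟧ ∧ ⟦ B ⟧
  ⟦ A ∨' B ⟧    = ⟦ A ⟧ ∨ ⟦ B ⟧
  ⟦ A →' B ⟧    = ⟦ A ⟧ ⇾ ⟦ B ⟧
  ⟦ ∇' A ⟧      = ∇ ⟦ A ⟧
  ⟦ sup h A B ⟧ = Σ.proj₁ (lower (inV H h)) ⟦ A ⟧ ⟦ B ⟧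

  ⋀ : List (Form C) → Carrier
  ⋀ = foldr (λ A acc → ⟦ A ⟧ ∧ acc) ⊤

  ⋁ : Maybe (Form C) → Carrier
  ⋁ = maybe ⟦_⟧ ⊥

  Sat : Sequent C → Set ℓ₂
  Sat (Γ ⇒ Δ) = ⋀ Γ ≤ ⋁ Δ

Conseq : (c ℓ₁ ℓ₂ : Level) (C : Sub) {I : Set} → (I → Sequent C) → Sequent C
       → Set (lsuc (c ⊔ ℓ₁ ⊔ ℓ₂))
Conseq c ℓ₁ ℓ₂ C {I} P S =
  (𝔸 : NablaAlgebra c ℓ₁ ℓ₂) (inV : InV C 𝔸) (V : ℕ → NablaAlgebra.Carrier 𝔸)
  → (∀ i → Sat 𝔸 inV V (P i)) → Sat 𝔸 inV V S

{-# OPTIONS --safe #-}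
module Submission where

-- Soundness is an induction over derivations: every rule of STL(C) is an order-theoretic fact
-- about ∇-algebras, each optional rule using its own property. The delicate one is Fu: taking
-- a = ⊤ in the defining adjunction shows ∇ ⊣ (⊤ ⇾ _), so when ⊤ ⇾ _ is surjective ∇ reflects ≤
-- and the rule can be checked after applying ∇.
-- Completeness uses the Lindenbaum–Tarski algebra of formulas preordered by derivability of
-- A ⇒ B from the premises (interderivability serving as its equality). It lies in 𝒱(C), the
-- canonical valuation validates the premises, and it validates Γ ⇒ Δ exactly when ⋀Γ ⇒ ⋁Δ,
-- equivalently Γ ⇒ Δ, is derivable.

open import Defs
open import Level using (Level; Lift; lift; lower)
open import Function.Base using (id)
open import Function.Bundles using (_⇔_; mk⇔; Equivalence)
open import Data.Nat using (ℕ)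
open import Data.List using (List; []; _∷_; _++_; foldr)
open import Data.List.Properties using (++-identityʳ)
open import Data.Maybe using (Maybe; just; nothing; maybe)
open import Data.Product using (_×_; _,_; proj₁; proj₂)
open import Relation.Binary.Core using (Rel)
open import Relation.Binary.PropositionalEquality as ≡ using (_≡_)
open import Data.List.Relation.Binary.Permutation.Propositional as ↭ using (_↭_; ↭-sym)
open import Data.List.Relation.Binary.Permutation.Propositional.Properties using (shift; ++-comm)
open import Relation.Binary.Lattice.Bundles using (BoundedLattice)
import Relation.Binary.Lattice.Properties.MeetSemilattice as MeetSemilatticeProperties

module DerivedRules {C : Sub} {I : Set} (P : I → Sequent C) where

  infix 3 _⊢_ _≼_

  _⊢_ : List (Form C) → Maybe (Form C) → Set
  Γ ⊢ Δ = Der C P (Γ ⇒ Δ)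

  _≼_ : Form C → Form C → Set
  A ≼ B = A ∷ [] ⊢ just B

  ⋀ᶠ : List (Form C) → Form C
  ⋀ᶠ = foldr _∧'_ ⊤'

  ⋁ᶠ : Maybe (Form C) → Form C
  ⋁ᶠ = maybe id ⊥'

  weaken-++ˡ : ∀ Γ {Π Δ} → Π ⊢ Δ → Γ ++ Π ⊢ Δ
  weaken-++ˡ []      d = d
  weaken-++ˡ (A ∷ Γ) d = wkL A (weaken-++ˡ Γ d)

  weaken-++ʳ : ∀ Γ {Π Δ} → Π ⊢ Δ → Π ++ Γ ⊢ Δ
  weaken-++ʳ Γ {Π} d = exch (++-comm Γ Π) (weaken-++ˡ Γ d)

  exch-swap : ∀ {A B Π Δ} → A ∷ B ∷ Π ⊢ Δ → B ∷ A ∷ Π ⊢ Δ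
  exch-swap = exch (↭.swap _ _ ↭.refl)

  ∧-pair : ∀ {A B} → A ∷ B ∷ [] ⊢ just (A ∧' B)
  ∧-pair {A} {B} = ∧R (weaken-++ʳ (B ∷ []) (ax A)) (wkL A (ax B))

  ∧L-pair : ∀ {A B Π Δ} → A ∷ B ∷ Π ⊢ Δ → A ∧' B ∷ Π ⊢ Δ
  ∧L-pair {A} {B} d = ctr (∧L₁ B (exch-swap (∧L₂ A (exch-swap d))))

  ∧L-unpair : ∀ {A B Δ} → A ∧' B ∷ [] ⊢ Δ → A ∷ B ∷ [] ⊢ Δ
  ∧L-unpair = cut ∧-pair

  →-mp : ∀ {A B} → ∇' (A →' B) ∷ A ∷ [] ⊢ just B
  →-mp {A} {B} = →L (ax A) (weaken-++ʳ (A ∷ []) (ax B))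

  ⊃-mp : (h : H ∈C C) → ∀ {A B} → sup h A B ∷ A ∷ [] ⊢ just B
  ⊃-mp h {A} {B} = ruleH⊃L h (ax A) (weaken-++ʳ (A ∷ []) (ax B))

  ⋀ᶠ-R : ∀ Γ → Γ ⊢ just (⋀ᶠ Γ)
  ⋀ᶠ-R []      = ax⊤
  ⋀ᶠ-R (A ∷ Γ) = ∧R (weaken-++ʳ Γ (ax A)) (wkL A (⋀ᶠ-R Γ))

  ⋀ᶠ-L : ∀ Γ {Π Δ} → Γ ++ Π ⊢ Δ → ⋀ᶠ Γ ∷ Π ⊢ Δ
  ⋀ᶠ-L []      d = wkL ⊤' d
  ⋀ᶠ-L (A ∷ Γ) {Π} d = ∧L-pair (exch-swap (⋀ᶠ-L Γ (exch (↭-sym (shift A Γ Π)) d)))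

  ⋁ᶠ-R : ∀ {Γ} Δ → Γ ⊢ Δ → Γ ⊢ just (⋁ᶠ Δ)
  ⋁ᶠ-R nothing  d = wkR ⊥' d
  ⋁ᶠ-R (just A) d = d

  ⋁ᶠ-L : ∀ Δ → ⋁ᶠ Δ ∷ [] ⊢ Δ
  ⋁ᶠ-L nothing  = ax⊥
  ⋁ᶠ-L (just A) = ax A

  ⊢⇔⋀ᶠ≼⋁ᶠ : ∀ Γ Δ → (Γ ⊢ Δ) ⇔ (⋀ᶠ Γ ≼ ⋁ᶠ Δ)
  ⊢⇔⋀ᶠ≼⋁ᶠ Γ Δ = mk⇔
    (λ d → ⋀ᶠ-L Γ (≡.subst (_⊢ just (⋁ᶠ Δ)) (≡.sym (++-identityʳ Γ)) (⋁ᶠ-R Δ d)))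
    (λ e → cut (⋀ᶠ-R Γ) (cut e (⋁ᶠ-L Δ)))

module NablaAlgebraProperties {c ℓ₁ ℓ₂} (𝔸 : NablaAlgebra c ℓ₁ ℓ₂) where
  open NablaAlgebra 𝔸
  open MeetSemilatticeProperties meetSemilattice using (∧-comm)
  open MeetSemilatticeProperties meetSemilattice using (∧-monotonic) public

  infixr 4 _⨾_
  _⨾_ : ∀ {x y z} → x ≤ y → y ≤ z → x ≤ z
  _⨾_ = trans

  x≤x∧⊤ : ∀ {x} → x ≤ x ∧ ⊤
  x≤x∧⊤ = ∧-greatest refl (maximum _)

  ∧-swap : ∀ {x y} → x ∧ y ≤ y ∧ x
  ∧-swap = reflexive (∧-comm _ _)

  detach : ∀ {f a b x y} → f ∧ a ≤ b → x ≤ a → b ∧ x ≤ y → f ∧ x ≤ y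
  detach fa≤b x≤a bx≤y =
    ∧-greatest (∧-monotonic refl x≤a) (x∧y≤y _ _) ⨾ ∧-monotonic fa≤b refl ⨾ bx≤y

  ∇⊣⊤⇾ : ∀ {x y} → (∇ x ≤ y) ⇔ (x ≤ ⊤ ⇾ y)
  ∇⊣⊤⇾ = mk⇔ (λ ∇x≤y → Equivalence.to (adj _ _ _) (x∧y≤x _ _ ⨾ ∇x≤y))
             (λ x≤⊤⇾y → x≤x∧⊤ ⨾ Equivalence.from (adj _ _ _) x≤⊤⇾y)

  modus-ponens : ∀ {a b} → ∇ (a ⇾ b) ∧ a ≤ b
  modus-ponens = Equivalence.from (adj _ _ _) refl

  ∇-mono : ∀ {x y} → x ≤ y → ∇ x ≤ ∇ y
  ∇-mono x≤y = Equivalence.from ∇⊣⊤⇾ (x≤y ⨾ Equivalence.to ∇⊣⊤⇾ refl)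

  ∇⊥≤⊥ : ∇ ⊥ ≤ ⊥
  ∇⊥≤⊥ = Equivalence.from ∇⊣⊤⇾ (minimum _)

  ∇-∧ : ∀ {x y} → ∇ (x ∧ y) ≤ ∇ x ∧ ∇ y
  ∇-∧ = ∧-greatest (∇-mono (x∧y≤x _ _)) (∇-mono (x∧y≤y _ _))

  ∇-reflects-≤ : Holds Fu 𝔸 → ∀ {x y} → ∇ x ≤ ∇ y → x ≤ y
  ∇-reflects-≤ (lift surj) {x} {y} ∇x≤∇y with surj y
  ... | z , ⊤⇾z≈y =
    Equivalence.to ∇⊣⊤⇾ (∇x≤∇y ⨾ Equivalence.from ∇⊣⊤⇾ (reflexive (Eq.sym ⊤⇾z≈y)))
    ⨾ reflexive ⊤⇾z≈y

module Soundness {c ℓ₁ ℓ₂} {C : Sub} (𝔸 : NablaAlgebra c ℓ₁ ℓ₂) (inV : InV C 𝔸)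
                 (V : ℕ → NablaAlgebra.Carrier 𝔸) where
  open NablaAlgebra 𝔸
  open NablaAlgebraProperties 𝔸

  ⟪_⟫ : Form C → Carrier
  ⟪_⟫ = ⟦_⟧ 𝔸 inV V

  ⋀ᵛ : List (Form C) → Carrier
  ⋀ᵛ = ⋀ 𝔸 inV V

  ⋁ᵛ : Maybe (Form C) → Carrier
  ⋁ᵛ = ⋁ 𝔸 inV V

  ⋀-++ˡ : ∀ Π Γ → ⋀ᵛ (Π ++ Γ) ≤ ⋀ᵛ Π
  ⋀-++ˡ []      Γ = maximum _
  ⋀-++ˡ (A ∷ Π) Γ = ∧-monotonic refl (⋀-++ˡ Π Γ)

  ⋀-++ʳ : ∀ Π Γ → ⋀ᵛ (Π ++ Γ) ≤ ⋀ᵛ Γ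
  ⋀-++ʳ []      Γ = refl
  ⋀-++ʳ (A ∷ Π) Γ = x∧y≤y _ _ ⨾ ⋀-++ʳ Π Γ

  ⋀-mono-↭ : ∀ {Γ Γ'} → Γ ↭ Γ' → ⋀ᵛ Γ ≤ ⋀ᵛ Γ'
  ⋀-mono-↭ ↭.refl         = refl
  ⋀-mono-↭ (↭.prep A p)   = ∧-monotonic refl (⋀-mono-↭ p)
  ⋀-mono-↭ (↭.swap A B p) =
    ∧-greatest (x∧y≤y _ _ ⨾ x∧y≤x _ _) (∧-monotonic refl (x∧y≤y _ _ ⨾ ⋀-mono-↭ p))
  ⋀-mono-↭ (↭.trans p q)  = ⋀-mono-↭ p ⨾ ⋀-mono-↭ q

  ∇-⋀ : ∀ Γ → ∇ (⋀ᵛ Γ) ≤ ⋀ᵛ (∇L Γ)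
  ∇-⋀ []      = maximum _
  ∇-⋀ (A ∷ Γ) = ∇-∧ ⨾ ∧-monotonic refl (∇-⋀ Γ)

  ⋀-∇ : Holds N 𝔸 → ∀ Γ → ⋀ᵛ (∇L Γ) ≤ ∇ (⋀ᵛ Γ)
  ⋀-∇ (lift (∇⊤≈⊤ , _))     []      = reflexive (Eq.sym ∇⊤≈⊤)
  ⋀-∇ n@(lift (_ , ∇-∧≈)) (A ∷ Γ) = ∧-monotonic refl (⋀-∇ n Γ) ⨾ reflexive (Eq.sym (∇-∧≈ _ _))

  ∇-⋁ : ∀ Δ → ∇ (⋁ᵛ Δ) ≤ ⋁ᵛ (∇M Δ)
  ∇-⋁ nothing  = ∇⊥≤⊥
  ∇-⋁ (just A) = refl

  ⋁-∇ : ∀ Δ → ⋁ᵛ (∇M Δ) ≤ ∇ (⋁ᵛ Δ)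
  ⋁-∇ nothing  = minimum _
  ⋁-∇ (just A) = refl

  sound : ∀ {I} {P : I → Sequent C} → (∀ i → Sat 𝔸 inV V (P i))
        → ∀ {S} → Der C P S → Sat 𝔸 inV V S
  sound ⊨P (prem i)   = ⊨P i
  sound ⊨P (exch p d) = ⋀-mono-↭ (↭-sym p) ⨾ sound ⊨P d
  sound ⊨P (ax A)     = x∧y≤x _ _
  sound ⊨P ax⊥        = x∧y≤x _ _
  sound ⊨P ax⊤        = refl
  sound ⊨P (wkL A d)  = x∧y≤y _ _ ⨾ sound ⊨P d
  sound ⊨P (wkR A d)  = sound ⊨P d ⨾ minimum _
  sound ⊨P (ctr d)    = ∧-greatest (x∧y≤x _ _) refl ⨾ sound ⊨P d
  sound ⊨P (cut {Γ} {Π} d e) =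
    ∧-greatest (⋀-++ʳ Π Γ ⨾ sound ⊨P d) (⋀-++ˡ Π Γ) ⨾ sound ⊨P e
  sound ⊨P (∧L₁ B d)  = ∧-monotonic (x∧y≤x _ _) refl ⨾ sound ⊨P d
  sound ⊨P (∧L₂ A d)  = ∧-monotonic (x∧y≤y _ _) refl ⨾ sound ⊨P d
  sound ⊨P (∧R d e)   = ∧-greatest (sound ⊨P d) (sound ⊨P e)
  sound ⊨P (∨L d e)   =
    x∧y≤x _ _ ⨾ ∨-least (x≤x∧⊤ ⨾ sound ⊨P d) (x≤x∧⊤ ⨾ sound ⊨P e)
  sound ⊨P (∨R₁ B d)  = sound ⊨P d ⨾ x≤x∨y _ _
  sound ⊨P (∨R₂ A d)  = sound ⊨P d ⨾ y≤x∨y _ _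
  sound ⊨P (∇mon d)   = x∧y≤x _ _ ⨾ ∇-mono (x≤x∧⊤ ⨾ sound ⊨P d)
  sound ⊨P (→L d e)   = detach modus-ponens (sound ⊨P d) (sound ⊨P e)
  sound ⊨P (→R {Γ} d) =
    Equivalence.to (adj _ _ _) (∧-swap ⨾ ∧-monotonic refl (∇-⋀ Γ) ⨾ sound ⊨P d)
  sound ⊨P (ruleR r d) = sound ⊨P d ⨾ lower (inV R r) _
  sound ⊨P (ruleL l d) = ∧-monotonic (lower (inV L l) _) refl ⨾ sound ⊨P d
  sound ⊨P (ruleD dist {Γ} {A = A} {B} d e) =
    ∧-swap ⨾ reflexive (lower (inV D dist) (⋀ᵛ Γ) ⟪ A ⟫ ⟪ B ⟫)
    ⨾ ∨-least (∧-swap ⨾ sound ⊨P d) (∧-swap ⨾ sound ⊨P e)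
  sound ⊨P (ruleN n {Γ} {Δ} d) = ⋀-∇ (inV N n) Γ ⨾ ∇-mono (sound ⊨P d) ⨾ ∇-⋁ Δ
  sound ⊨P (ruleFa fa {Γ} d) with lower (inV Fa fa) (⋀ᵛ Γ)
  ... | x , ∇x≈⋀Γ = reflexive (Eq.sym ∇x≈⋀Γ)
    ⨾ ∇-mono (Equivalence.to (adj _ _ _)
                (∧-monotonic (reflexive ∇x≈⋀Γ) refl ⨾ ∧-swap ⨾ sound ⊨P d))
  sound ⊨P (ruleFu fu {Γ} {Δ} d e) = ∇-reflects-≤ (inV Fu fu)
    (∇-∧ ⨾ ∧-monotonic refl (∇-⋀ Γ) ⨾ detach modus-ponens (sound ⊨P d) (sound ⊨P e) ⨾ ⋁-∇ Δ)
  sound ⊨P (ruleH⊃L h d e) =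
    detach (proj₂ (proj₂ (lower (inV H h)) _ _ _) refl) (sound ⊨P d) (sound ⊨P e)
  sound ⊨P (ruleH⊃R h d) = proj₁ (proj₂ (lower (inV H h)) _ _ _) (∧-swap ⨾ sound ⊨P d)

module Lindenbaum (c ℓ₁ ℓ₂ : Level) {C : Sub} {I : Set} (P : I → Sequent C) where
  open DerivedRules P

  Carrier : Set c
  Carrier = Lift c (Form C)

  _≤ᴸ_ : Rel Carrier ℓ₂
  x ≤ᴸ y = Lift ℓ₂ (lower x ≼ lower y)

  _≈ᴸ_ : Rel Carrier ℓ₁
  x ≈ᴸ y = Lift ℓ₁ ((lower x ≼ lower y) × (lower y ≼ lower x))

  lift₁ : (Form C → Form C) → Carrier → Carrier
  lift₁ f x = lift (f (lower x))

  lift₂ : (Form C → Form C → Form C) → Carrier → Carrier → Carrier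
  lift₂ f x y = lift (f (lower x) (lower y))

  boundedLattice : BoundedLattice c ℓ₁ ℓ₂
  boundedLattice = record
    { Carrier = Carrier
    ; _≈_ = _≈ᴸ_
    ; _≤_ = _≤ᴸ_
    ; _∨_ = lift₂ _∨'_
    ; _∧_ = lift₂ _∧'_
    ; ⊤ = lift ⊤'
    ; ⊥ = lift ⊥'
    ; isBoundedLattice = record
      { isLattice = record
        { isPartialOrder = record
          { isPreorder = record
            { isEquivalence = record
              { refl  = lift (ax _ , ax _)
              ; sym   = λ { (lift (p , q)) → lift (q , p) }
              ; trans = λ { (lift (p , q)) (lift (p' , q')) → lift (cut p p' , cut q' q) }
              }
            ; reflexive = λ { (lift (p , _)) → lift p }
            ; trans = λ { (lift p) (lift q) → lift (cut p q) }
            }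
          ; antisym = λ { (lift p) (lift q) → lift (p , q) }
          }
        ; supremum = λ _ _ → lift (∨R₁ _ (ax _)) , lift (∨R₂ _ (ax _))
                           , λ _ → λ { (lift p) (lift q) → lift (∨L p q) }
        ; infimum  = λ _ _ → lift (∧L₁ _ (ax _)) , lift (∧L₂ _ (ax _))
                           , λ _ → λ { (lift p) (lift q) → lift (∧R p q) }
        }
      ; maximum = λ _ → lift (wkL _ ax⊤)
      ; minimum = λ _ → lift (wkR _ ax⊥)
      }
    }

  𝕃 : NablaAlgebra c ℓ₁ ℓ₂
  𝕃 = record
    { boundedLattice = boundedLattice
    ; ∇   = lift₁ ∇'
    ; _⇾_ = lift₂ _→'_
    ; adj = λ _ _ _ → mk⇔
        (λ { (lift d) → lift (→R (exch-swap (∧L-unpair d))) })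
        (λ { (lift e) → lift (∧L-pair (exch-swap (cut (∇mon e) →-mp))) })
    }

  𝕃-N : N ∈C C → Holds N 𝕃
  𝕃-N n = lift
    ( lift (wkL _ ax⊤ , wkL ⊤' (ruleN n ax⊤))
    , λ _ _ → lift (∧R (∇mon (∧L₁ _ (ax _))) (∇mon (∧L₂ _ (ax _))) , ∧L-pair (ruleN n ∧-pair)))

  𝕃-H : (h : H ∈C C) → Holds H 𝕃
  𝕃-H h = lift
    ( lift₂ (sup h)
    , λ _ _ _ → (λ { (lift d) → lift (ruleH⊃R h (exch-swap (∧L-unpair d))) })
              , (λ { (lift e) → lift (∧L-pair (exch-swap (cut e (⊃-mp h)))) }))

  𝕃-D : D ∈C C → Holds D 𝕃
  𝕃-D dist = lift λ _ _ _ → lift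
    ( ∧L-pair (exch-swap (ruleD dist (∨R₁ _ (exch-swap ∧-pair)) (∨R₂ _ (exch-swap ∧-pair))))
    , ∨L (∧R (∧L₁ _ (ax _)) (∧L₂ _ (∨R₁ _ (ax _)))) (∧R (∧L₁ _ (ax _)) (∧L₂ _ (∨R₂ _ (ax _)))))

  𝕃-R : R ∈C C → Holds R 𝕃
  𝕃-R r = lift λ _ → lift (ruleR r (ax _))

  𝕃-L : L ∈C C → Holds L 𝕃
  𝕃-L l = lift λ _ → lift (ruleL l (ax _))

  𝕃-Fa : Fa ∈C C → Holds Fa 𝕃
  𝕃-Fa fa = lift λ x → lift (⊤' →' lower x)
    , lift (→L {Γ = []} ax⊤ (ax _) , ruleFa fa (wkL ⊤' (ax _)))

  𝕃-Fu : Fu ∈C C → Holds Fu 𝕃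
  𝕃-Fu fu = lift λ x → lift (∇' (lower x))
    , lift (ruleFu fu {Γ = []} {Δ = just (lower x)} ax⊤ (ax _) , →R (wkL ⊤' (ax _)))

  𝕃∈V : InV C 𝕃
  𝕃∈V N  = 𝕃-N
  𝕃∈V H  = 𝕃-H
  𝕃∈V D  = 𝕃-D
  𝕃∈V R  = 𝕃-R
  𝕃∈V L  = 𝕃-L
  𝕃∈V Fa = 𝕃-Fa
  𝕃∈V Fu = 𝕃-Fu

  canonical : ℕ → Carrier
  canonical n = lift (var n)

  ⟦⟧-canonical : ∀ A → ⟦_⟧ 𝕃 𝕃∈V canonical A ≡ lift A
  ⟦⟧-canonical (var n)     = ≡.refl
  ⟦⟧-canonical ⊤'          = ≡.refl
  ⟦⟧-canonical ⊥'          = ≡.refl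
  ⟦⟧-canonical (A ∧' B)    = ≡.cong₂ (lift₂ _∧'_) (⟦⟧-canonical A) (⟦⟧-canonical B)
  ⟦⟧-canonical (A ∨' B)    = ≡.cong₂ (lift₂ _∨'_) (⟦⟧-canonical A) (⟦⟧-canonical B)
  ⟦⟧-canonical (A →' B)    = ≡.cong₂ (lift₂ _→'_) (⟦⟧-canonical A) (⟦⟧-canonical B)
  ⟦⟧-canonical (∇' A)      = ≡.cong (lift₁ ∇') (⟦⟧-canonical A)
  ⟦⟧-canonical (sup h A B) = ≡.cong₂ (lift₂ (sup h)) (⟦⟧-canonical A) (⟦⟧-canonical B)

  ⋀-canonical : ∀ Γ → ⋀ 𝕃 𝕃∈V canonical Γ ≡ lift (⋀ᶠ Γ)
  ⋀-canonical []      = ≡.refl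
  ⋀-canonical (A ∷ Γ) = ≡.cong₂ (lift₂ _∧'_) (⟦⟧-canonical A) (⋀-canonical Γ)

  ⋁-canonical : ∀ Δ → ⋁ 𝕃 𝕃∈V canonical Δ ≡ lift (⋁ᶠ Δ)
  ⋁-canonical nothing  = ≡.refl
  ⋁-canonical (just A) = ⟦⟧-canonical A

  Sat-canonical⇔⊢ : ∀ Γ Δ → Sat 𝕃 𝕃∈V canonical (Γ ⇒ Δ) ⇔ (Γ ⊢ Δ)
  Sat-canonical⇔⊢ Γ Δ rewrite ⋀-canonical Γ | ⋁-canonical Δ =
    mk⇔ (λ s → from (lower s)) (λ d → lift (to d))
    where open Equivalence (⊢⇔⋀ᶠ≼⋁ᶠ Γ Δ)

  complete : ∀ {S} → Conseq c ℓ₁ ℓ₂ C P S → Der C P S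
  complete {Γ ⇒ Δ} ⊨S =
    Equivalence.to (Sat-canonical⇔⊢ Γ Δ)
      (⊨S 𝕃 𝕃∈V canonical λ i → Equivalence.from (Sat-canonical⇔⊢ _ _) (prem i))

theorem6p5 : ∀ {c ℓ₁ ℓ₂ : Level} (C : Sub) {I : Set} (P : I → Sequent C) (S : Sequent C)
    → Der C P S ⇔ Conseq c ℓ₁ ℓ₂ C P S
theorem6p5 {c} {ℓ₁} {ℓ₂} _ P _ =
  mk⇔ (λ d 𝔸 inV V ⊨P → Soundness.sound 𝔸 inV V ⊨P d) (Lindenbaum.complete c ℓ₁ ℓ₂ P)
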